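{- Let $p$ be a positive even integer, $d(a,b)$ the cyclic distance modulo $p$, and $v^0,\dots,v^{p-1}\in\mathbb{R}^N$ unit vectors with $v^a\cdot v^b=1-\frac{4d(a,b)}{p}$ for all $a,b$. Let $a,b,c,d\in\{0,1,\dots,p/2\}$ with $a\le b$, $c\le d$, such that the intervals $[a,b]$ and $[c,d]$ are non-overlapping (their interiors are disjoint). Then $(v^a-v^b)\cdot(v^c-v^d)=0$.
   Context: $d(a,b)=\min\{|b-a|\bmod p,\ p-(|b-a|\bmod p)\}$. -}

module Defs where

open import Level using (Level)
open import Data.Nat using (ℕ; zero; suc; NonZero; ∣_-_∣; _⊓_; _∸_; _≤_)
open import Data.Nat.DivMod using (_%_)
open import Data.Vec using (Vec; zipWith; foldr)
open import Data.Sum using (_⊎_)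
open import Relation.Binary.PropositionalEquality using (_≡_)
open import Algebra.Bundles using (CommutativeRing)

cycDist : (p : ℕ) → .{{NonZero p}} → ℕ → ℕ → ℕ
cycDist p a b = (∣ b - a ∣ % p) ⊓ (p ∸ (∣ b - a ∣ % p))

InteriorsDisjoint : ℕ → ℕ → ℕ → ℕ → Set
InteriorsDisjoint a b c d = a ≡ b ⊎ c ≡ d ⊎ b ≤ c ⊎ d ≤ a

module VecOps {c ℓ : Level} (R : CommutativeRing c ℓ) where
  open CommutativeRing R

  ι : ℕ → Carrier
  ι zero = 0#
  ι (suc n) = 1# + ι n

  _-ᴿ_ : Carrier → Carrier → Carrier
  x -ᴿ y = x + (- y)

  _·_ : ∀ {N} → Vec Carrier N → Vec Carrier N → Carrier
  u · w = foldr _ _+_ 0# (zipWith _*_ u w)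

  _⊖_ : ∀ {N} → Vec Carrier N → Vec Carrier N → Vec Carrier N
  u ⊖ w = zipWith _-ᴿ_ u w

-- On {0, …, p/2} the cyclic distance is the ordinary distance |x − y|.
-- Expanding the dot product with the Gram identity v^x · v^y = 1 − (4/p) d(x,y) gives
-- (v^a − v^b)·(v^c − v^d) = (4/p) (d(a,d) + d(b,c) − d(a,c) − d(b,d)), and for two
-- intervals of a line with disjoint interiors |a − c| + |b − d| = |a − d| + |b − c|.
module Submission where

open import Defs
open import Data.Nat using (ℕ; NonZero; _≤_) renaming (_*_ to _*ℕ_)
open import Data.Nat.Divisibility using (_∣_)
open import Data.Fin using (Fin; toℕ)
open import Data.Vec using (Vec)
open import Algebra.Bundles using (CommutativeRing)

open import Data.Nat as Nat using (zero; suc; _<_; _∸_; _⊓_; ∣_-_∣; z≤n; s≤s)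
open import Data.Nat.Properties
  using (≤-trans; ≤-<-trans; +-comm; +-identityʳ; *-monoʳ-≤; *-distribˡ-⊔; ⊔-lub; ⊔-pres-<m;
         m≤n⇒m⊓n≡m; m+n≤o⇒m≤o∸n; ∣m-n∣≤m⊔n; ∣-∣-comm)
open import Data.Nat.DivMod using (_%_; m<n⇒m%n≡m)
open import Data.Nat.Tactic.RingSolver using (solve-∀)
open import Data.Fin.Properties using (toℕ<n)
open import Data.Sum using (inj₁; inj₂)
open import Data.Vec using ([]; _∷_)
open import Data.Maybe using (nothing)
open import Relation.Binary.PropositionalEquality as ≡ using (_≡_)
open import Tactic.RingSolver.Core.AlmostCommutativeRing using (fromCommutativeRing)

module GramIdentity {c ℓ} (R : CommutativeRing c ℓ) where
  open CommutativeRing R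
  open VecOps R
  open import Tactic.RingSolver.NonReflective (fromCommutativeRing R (λ _ → nothing))
    using (solve; _⊜_; _⊕_; _⊗_; ⊝_)
  open import Algebra.Properties.Ring ring using (-‿distribˡ-*; -‿distribʳ-*; -‿involutive)
  open import Relation.Binary.Reasoning.Setoid setoid

  ι-+-homo : ∀ m n → ι (m Nat.+ n) ≈ ι m + ι n
  ι-+-homo zero    n = sym (+-identityˡ (ι n))
  ι-+-homo (suc m) n = trans (+-cong refl (ι-+-homo m n)) (sym (+-assoc 1# (ι m) (ι n)))

  -x*-y≈x*y : ∀ x y → - x * - y ≈ x * y
  -x*-y≈x*y x y = begin
    - x * - y    ≈⟨ -‿distribˡ-* x (- y) ⟨
    - (x * - y)  ≈⟨ -‿cong (-‿distribʳ-* x y) ⟨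
    - - (x * y)  ≈⟨ -‿involutive (x * y) ⟩
    x * y        ∎

  -- The solver cannot identify - - 1# with 1#, so the product of the two negated
  -- terms is expanded with the negations kept as atoms.
  [u-w][x-y]≈[ux+wy]-[uy+wx] : ∀ u w x y → (u -ᴿ w) * (x -ᴿ y) ≈ (u * x + w * y) -ᴿ (u * y + w * x)
  [u-w][x-y]≈[ux+wy]-[uy+wx] u w x y = begin
    (u + - w) * (x + - y)
      ≈⟨ solve 4 (λ u W x Y → ((u ⊕ W) ⊗ (x ⊕ Y)) ⊜ ((u ⊗ x ⊕ u ⊗ Y) ⊕ (W ⊗ x ⊕ W ⊗ Y)))
           refl u (- w) x (- y) ⟩
    (u * x + u * - y) + (- w * x + - w * - y)
      ≈⟨ +-cong (+-cong refl (sym (-‿distribʳ-* u y))) (+-cong (sym (-‿distribˡ-* w x)) (-x*-y≈x*y w y)) ⟩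
    (u * x + - (u * y)) + (- (w * x) + w * y)
      ≈⟨ solve 4 (λ ux uy wx wy → ((ux ⊕ ⊝ uy) ⊕ (⊝ wx ⊕ wy)) ⊜ ((ux ⊕ wy) ⊕ ⊝ (uy ⊕ wx)))
           refl (u * x) (u * y) (w * x) (w * y) ⟩
    (u * x + w * y) -ᴿ (u * y + w * x) ∎

  ⊖-·-⊖ : ∀ {N} (u w x y : Vec Carrier N) → (u ⊖ w) · (x ⊖ y) ≈ (u · x + w · y) -ᴿ (u · y + w · x)
  ⊖-·-⊖ []       []       []       []       = sym (-‿inverseʳ (0# + 0#))
  ⊖-·-⊖ (u ∷ us) (w ∷ ws) (x ∷ xs) (y ∷ ys) =
    trans (+-cong ([u-w][x-y]≈[ux+wy]-[uy+wx] u w x y) (⊖-·-⊖ us ws xs ys))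
      (solve 8 (λ ux wy uy wx A B C D →
          (((ux ⊕ wy) ⊕ ⊝ (uy ⊕ wx)) ⊕ ((A ⊕ B) ⊕ ⊝ (C ⊕ D)))
        ⊜ (((ux ⊕ A) ⊕ (wy ⊕ B)) ⊕ ⊝ ((uy ⊕ C) ⊕ (wx ⊕ D))))
        refl (u * x) (w * y) (u * y) (w * x) (us · xs) (ws · ys) (us · ys) (ws · xs))

  [1-kmq]+[1-knq]≈2-k[m+n]q : ∀ k q m n →
    (1# -ᴿ (k * m * q)) + (1# -ᴿ (k * n * q)) ≈ (1# + 1#) -ᴿ (k * (m + n) * q)
  [1-kmq]+[1-knq]≈2-k[m+n]q k q m n = begin
    (1# + - (k * m * q)) + (1# + - (k * n * q))
      ≈⟨ solve 3 (λ o a b → ((o ⊕ ⊝ a) ⊕ (o ⊕ ⊝ b)) ⊜ ((o ⊕ o) ⊕ ⊝ (a ⊕ b)))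
           refl 1# (k * m * q) (k * n * q) ⟩
    (1# + 1#) + - (k * m * q + k * n * q)
      ≈⟨ +-cong refl (-‿cong (solve 4 (λ k q m n → (k ⊗ m ⊗ q ⊕ k ⊗ n ⊗ q) ⊜ (k ⊗ (m ⊕ n) ⊗ q))
                                  refl k q m n)) ⟩
    (1# + 1#) + - (k * (m + n) * q) ∎

  gram⇒⊖-·-⊖≈0 : ∀ {I : Set} {N} (δ : I → I → ℕ) (k q : Carrier) (v : I → Vec Carrier N) →
    (∀ i j → v i · v j ≈ 1# -ᴿ (k * ι (δ i j) * q)) →
    ∀ a b c d → δ a c Nat.+ δ b d ≡ δ a d Nat.+ δ b c → (v a ⊖ v b) · (v c ⊖ v d) ≈ 0#
  gram⇒⊖-·-⊖≈0 δ k q v gram a b c d δ-sums = begin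
    (v a ⊖ v b) · (v c ⊖ v d)
      ≈⟨ ⊖-·-⊖ (v a) (v b) (v c) (v d) ⟩
    (v a · v c + v b · v d) -ᴿ (v a · v d + v b · v c)
      ≈⟨ +-cong (+-cong (gram a c) (gram b d)) (-‿cong (+-cong (gram a d) (gram b c))) ⟩
    (G (δ a c) + G (δ b d)) -ᴿ (G (δ a d) + G (δ b c))
      ≈⟨ +-cong G-sums refl ⟩
    (G (δ a d) + G (δ b c)) -ᴿ (G (δ a d) + G (δ b c))
      ≈⟨ -‿inverseʳ (G (δ a d) + G (δ b c)) ⟩
    0# ∎
    where
    G : ℕ → Carrier
    G m = 1# -ᴿ (k * ι m * q)
    G-sums : G (δ a c) + G (δ b d) ≈ G (δ a d) + G (δ b c)
    G-sums = begin
      G (δ a c) + G (δ b d)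
        ≈⟨ [1-kmq]+[1-knq]≈2-k[m+n]q k q (ι (δ a c)) (ι (δ b d)) ⟩
      (1# + 1#) -ᴿ (k * (ι (δ a c) + ι (δ b d)) * q)
        ≈⟨ +-cong refl (-‿cong (*-cong (*-cong refl ι-sums) refl)) ⟩
      (1# + 1#) -ᴿ (k * (ι (δ a d) + ι (δ b c)) * q)
        ≈⟨ [1-kmq]+[1-knq]≈2-k[m+n]q k q (ι (δ a d)) (ι (δ b c)) ⟨
      G (δ a d) + G (δ b c) ∎
      where
      ι-sums : ι (δ a c) + ι (δ b d) ≈ ι (δ a d) + ι (δ b c)
      ι-sums = begin
        ι (δ a c) + ι (δ b d)    ≈⟨ ι-+-homo (δ a c) (δ b d) ⟨
        ι (δ a c Nat.+ δ b d)    ≡⟨ ≡.cong ι δ-sums ⟩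
        ι (δ a d Nat.+ δ b c)    ≈⟨ ι-+-homo (δ a d) (δ b c) ⟩
        ι (δ a d) + ι (δ b c)    ∎

open Nat using (_+_)
open ≡ using (refl; cong; cong₂; sym; subst; module ≡-Reasoning)

m%n⊓[n∸m%n]≡m : ∀ {m n} .{{_ : NonZero n}} → m < n → 2 *ℕ m ≤ n → (m % n) ⊓ (n ∸ m % n) ≡ m
m%n⊓[n∸m%n]≡m {m} {n} m<n 2m≤n rewrite m<n⇒m%n≡m m<n =
  m≤n⇒m⊓n≡m (m+n≤o⇒m≤o∸n m (subst (_≤ n) (cong (m +_) (+-identityʳ m)) 2m≤n))

cycDist≡∣-∣ : ∀ p {x y} .{{_ : NonZero p}} → x < p → y < p → 2 *ℕ x ≤ p → 2 *ℕ y ≤ p →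
              cycDist p x y ≡ ∣ x - y ∣
cycDist≡∣-∣ p {x} {y} x<p y<p 2x≤p 2y≤p = begin
  cycDist p x y ≡⟨ m%n⊓[n∸m%n]≡m ∣y-x∣<p 2∣y-x∣≤p ⟩
  ∣ y - x ∣     ≡⟨ ∣-∣-comm y x ⟩
  ∣ x - y ∣     ∎
  where
  open ≡-Reasoning
  ∣y-x∣<p : ∣ y - x ∣ < p
  ∣y-x∣<p = ≤-<-trans (∣m-n∣≤m⊔n y x) (⊔-pres-<m y<p x<p)
  2∣y-x∣≤p : 2 *ℕ ∣ y - x ∣ ≤ p
  2∣y-x∣≤p = ≤-trans (*-monoʳ-≤ 2 (∣m-n∣≤m⊔n y x))
               (subst (_≤ p) (sym (*-distribˡ-⊔ 2 y x)) (⊔-lub 2y≤p 2x≤p))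

∣m-o∣≡∣m-n∣+∣n-o∣ : ∀ {m n o} → m ≤ n → n ≤ o → ∣ m - o ∣ ≡ ∣ m - n ∣ + ∣ n - o ∣
∣m-o∣≡∣m-n∣+∣n-o∣ {zero}  {zero}  z≤n       _         = refl
∣m-o∣≡∣m-n∣+∣n-o∣ {zero}  {suc n} z≤n       (s≤s n≤o) = cong suc (∣m-o∣≡∣m-n∣+∣n-o∣ {zero} z≤n n≤o)
∣m-o∣≡∣m-n∣+∣n-o∣ {suc m} {suc n} (s≤s m≤n) (s≤s n≤o) = ∣m-o∣≡∣m-n∣+∣n-o∣ m≤n n≤o

a≤b≤c≤d⇒∣a-c∣+∣b-d∣≡∣a-d∣+∣b-c∣ : ∀ {a b c d} → a ≤ b → b ≤ c → c ≤ d →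
  ∣ a - c ∣ + ∣ b - d ∣ ≡ ∣ a - d ∣ + ∣ b - c ∣
a≤b≤c≤d⇒∣a-c∣+∣b-d∣≡∣a-d∣+∣b-c∣ {a} {b} {c} {d} a≤b b≤c c≤d = begin
  ∣ a - c ∣ + ∣ b - d ∣
    ≡⟨ cong₂ _+_ (∣m-o∣≡∣m-n∣+∣n-o∣ a≤b b≤c) (∣m-o∣≡∣m-n∣+∣n-o∣ b≤c c≤d) ⟩
  (∣ a - b ∣ + ∣ b - c ∣) + (∣ b - c ∣ + ∣ c - d ∣)
    ≡⟨ rearrange ∣ a - b ∣ ∣ b - c ∣ ∣ c - d ∣ ⟩
  (∣ a - b ∣ + (∣ b - c ∣ + ∣ c - d ∣)) + ∣ b - c ∣
    ≡⟨ cong (λ t → (∣ a - b ∣ + t) + ∣ b - c ∣) (∣m-o∣≡∣m-n∣+∣n-o∣ b≤c c≤d) ⟨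
  (∣ a - b ∣ + ∣ b - d ∣) + ∣ b - c ∣
    ≡⟨ cong (_+ ∣ b - c ∣) (∣m-o∣≡∣m-n∣+∣n-o∣ a≤b (≤-trans b≤c c≤d)) ⟨
  ∣ a - d ∣ + ∣ b - c ∣ ∎
  where
  open ≡-Reasoning
  rearrange : ∀ x y z → (x + y) + (y + z) ≡ (x + (y + z)) + y
  rearrange = solve-∀

disjoint⇒∣a-c∣+∣b-d∣≡∣a-d∣+∣b-c∣ : ∀ {a b c d} → a ≤ b → c ≤ d → InteriorsDisjoint a b c d →
  ∣ a - c ∣ + ∣ b - d ∣ ≡ ∣ a - d ∣ + ∣ b - c ∣
disjoint⇒∣a-c∣+∣b-d∣≡∣a-d∣+∣b-c∣ {a} {_} {c} {d} _ _ (inj₁ refl) = +-comm ∣ a - c ∣ ∣ a - d ∣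
disjoint⇒∣a-c∣+∣b-d∣≡∣a-d∣+∣b-c∣ _ _ (inj₂ (inj₁ refl)) = refl
disjoint⇒∣a-c∣+∣b-d∣≡∣a-d∣+∣b-c∣ a≤b c≤d (inj₂ (inj₂ (inj₁ b≤c))) =
  a≤b≤c≤d⇒∣a-c∣+∣b-d∣≡∣a-d∣+∣b-c∣ a≤b b≤c c≤d
disjoint⇒∣a-c∣+∣b-d∣≡∣a-d∣+∣b-c∣ {a} {b} {c} {d} a≤b c≤d (inj₂ (inj₂ (inj₂ d≤a))) = begin
  ∣ a - c ∣ + ∣ b - d ∣ ≡⟨ cong₂ _+_ (∣-∣-comm a c) (∣-∣-comm b d) ⟩
  ∣ c - a ∣ + ∣ d - b ∣ ≡⟨ a≤b≤c≤d⇒∣a-c∣+∣b-d∣≡∣a-d∣+∣b-c∣ c≤d d≤a a≤b ⟩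
  ∣ c - b ∣ + ∣ d - a ∣ ≡⟨ +-comm ∣ c - b ∣ ∣ d - a ∣ ⟩
  ∣ d - a ∣ + ∣ c - b ∣ ≡⟨ cong₂ _+_ (∣-∣-comm d a) (∣-∣-comm c b) ⟩
  ∣ a - d ∣ + ∣ b - c ∣ ∎
  where open ≡-Reasoning

lemma3 : ∀ {c ℓ} (R : CommutativeRing c ℓ) →
    let open CommutativeRing R
        open VecOps R
    in (p : ℕ) .{{_ : NonZero p}} → 2 ∣ p →
       (p⁻¹ : Carrier) → ι p * p⁻¹ ≈ 1# →
       (N : ℕ) (v : Fin p → Vec Carrier N) →
       (∀ (a b : Fin p) → v a · v b ≈ 1# -ᴿ (ι 4 * ι (cycDist p (toℕ a) (toℕ b)) * p⁻¹)) →
       (a b c d : Fin p) →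
       2 *ℕ toℕ a ≤ p → 2 *ℕ toℕ b ≤ p → 2 *ℕ toℕ c ≤ p → 2 *ℕ toℕ d ≤ p →
       toℕ a ≤ toℕ b → toℕ c ≤ toℕ d →
       InteriorsDisjoint (toℕ a) (toℕ b) (toℕ c) (toℕ d) →
       (v a ⊖ v b) · (v c ⊖ v d) ≈ 0#
lemma3 R p _ p⁻¹ _ _ v gram a b c d 2a≤p 2b≤p 2c≤p 2d≤p a≤b c≤d disjoint =
  gram⇒⊖-·-⊖≈0 δ (ι 4) p⁻¹ v gram a b c d δ-sums
  where
  open GramIdentity R
  open VecOps R using (ι)
  δ : Fin p → Fin p → ℕ
  δ x y = cycDist p (toℕ x) (toℕ y)
  δ≡∣-∣ : ∀ x y → 2 *ℕ toℕ x ≤ p → 2 *ℕ toℕ y ≤ p → δ x y ≡ ∣ toℕ x - toℕ y ∣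
  δ≡∣-∣ x y = cycDist≡∣-∣ p (toℕ<n x) (toℕ<n y)
  δ-sums : δ a c + δ b d ≡ δ a d + δ b c
  δ-sums = begin
    δ a c + δ b d
      ≡⟨ cong₂ _+_ (δ≡∣-∣ a c 2a≤p 2c≤p) (δ≡∣-∣ b d 2b≤p 2d≤p) ⟩
    ∣ toℕ a - toℕ c ∣ + ∣ toℕ b - toℕ d ∣
      ≡⟨ disjoint⇒∣a-c∣+∣b-d∣≡∣a-d∣+∣b-c∣ a≤b c≤d disjoint ⟩
    ∣ toℕ a - toℕ d ∣ + ∣ toℕ b - toℕ c ∣
      ≡⟨ cong₂ _+_ (δ≡∣-∣ a d 2a≤p 2d≤p) (δ≡∣-∣ b c 2b≤p 2c≤p) ⟨
    δ a d + δ b c ∎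
    where open ≡-Reasoning
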